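{- Let $k$ be a positive integer and let $T$ be a tournament on $N\ge 3^{\binom{k+1}{2}}$ vertices. Then the number of distinct copies of $TT_k$ in $T$ is at least $3^{ -\binom{k+1}{2}}N^k$.
   Context: $TT_k$ denotes the transitive tournament on $k$ vertices; a copy of $TT_k$ in $T$ is a subtournament of $T$ isomorphic to $TT_k$. -}

module Defs where

open import Data.Nat using (ℕ; _<_)
open import Data.Fin using (Fin) renaming (_<_ to _<ᶠ_)
open import Data.Fin.Subset using (Subset; _∈_)
open import Data.Product using (Σ; ∃; _×_)
open import Data.Sum using (_⊎_)
open import Data.Empty using (⊥)
open import Relation.Nullary using (¬_)
open import Relation.Binary.PropositionalEquality using (_≡_; _≢_)
open import Function.Bundles using (_⇔_)
open import Function.Definitions using (Injective)
open import Level using (0ℓ; suc)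

record Tournament (N : ℕ) : Set₁ where
  field
    _⇒_      : Fin N → Fin N → Set
    irrefl   : ∀ u → ¬ (u ⇒ u)
    total    : ∀ u v → u ≢ v → (u ⇒ v) ⊎ (v ⇒ u)
    antisym  : ∀ u v → u ⇒ v → ¬ (v ⇒ u)

open Tournament public

IsCopyTT : ∀ {N} → Tournament N → (k : ℕ) → Subset N → Set
IsCopyTT {N} T k S =
  Σ (Fin k → Fin N) λ f →
      Injective _≡_ _≡_ f
    × (∀ v → v ∈ S ⇔ ∃ λ i → f i ≡ v)
    × (∀ i j → (_⇒_ T (f i) (f j)) ⇔ (i <ᶠ j))

{-# OPTIONS --safe #-}
module Submission where

-- Let v be any vertex and m the number of the others.  Either at least ⌈ m /2⌉ of
-- them are beaten by v or at least ⌈ m /2⌉ of them beat v, and every copy of TT_k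
-- on that side becomes a copy of TT_(k+1) once v is added as its source, resp.
-- sink; the copies avoiding v are counted recursively.  So an n-vertex tournament
-- contains at least ttBound k n copies of TT_k.  By induction on k and n,
-- (2 (n − (2^k − 1)))^k ≤ 3^C(k+1,2) · ttBound k n: passing from k to k+1 costs a
-- factor (k+1) 2^(k+1) ≤ 3^(k+1).  For n ≥ 3^C(k+1,2) ≥ 2^(k+1) − 1 the left side
-- is at least n^k.

open import Defs hiding (_⇒_; irrefl; total; antisym)
open import Data.Nat using (ℕ; zero; suc; pred; _≤_; _+_; _*_; _^_; _∸_; ⌈_/2⌉; ⌊_/2⌋; z≤n; s≤s)
open import Data.Nat.Properties
  using ( ≤-refl; ≤-trans; ≤-reflexive; ≤-total; n≤1+n; m≤m+n; m+n≤o⇒m≤o∸n; module ≤-Reasoning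
        ; +-comm; +-suc; +-identityʳ; *-comm; *-assoc; *-distribˡ-∸; ^-distribˡ-+-*
        ; +-mono-≤; +-monoˡ-≤; +-monoʳ-≤; *-mono-≤; *-monoˡ-≤; *-monoʳ-≤
        ; ^-monoˡ-≤; ^-monoʳ-≤; ∸-monoˡ-≤; m^n>0; pred[m∸n]≡m∸[1+n]
        ; ⌈n/2⌉-mono; n≡⌈n+n/2⌉; ⌊n/2⌋+⌈n/2⌉≡n; ⌊n/2⌋≤⌈n/2⌉ )
open import Data.Nat.Combinatorics using (_C_; nC1≡n; nCk+nC[k+1]≡[n+1]C[k+1])
open import Data.Nat.Tactic.RingSolver using (solve-∀)
open import Data.Fin using (Fin; zero; suc; _≟_) renaming (_<_ to _<ᶠ_)
open import Data.Fin.Properties using (<-cmp)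
open import Data.Fin.Subset using (Subset; ⋃; ⁅_⁆) renaming (_∈_ to _∈ₛ_)
open import Data.Fin.Subset.Properties using (x∈⁅x⁆; x∈⁅y⁆⇒x≡y; x∈p∪q⁺; x∈p∪q⁻; ∉⊥)
open import Data.List using (List; []; _∷_; _++_; _∷ʳ_; [_]; map; filter; length; lookup; allFin)
open import Data.List.Properties using (length-map; length-++; length-tabulate)
open import Data.List.Membership.Propositional using (_∈_; _∉_)
open import Data.List.Membership.Propositional.Properties using (∈-filter⁻; ∈-lookup)
open import Data.List.Relation.Binary.Subset.Propositional using (_⊆_)
open import Data.List.Relation.Binary.Subset.Propositional.Properties
  using (⊆∷∧∉⇒⊆; ⊆-reflexive-↭; filter-⊆)
open import Data.List.Relation.Binary.Permutation.Propositional using (_↭_; ↭-refl; ↭-sym)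
open import Data.List.Relation.Binary.Permutation.Propositional.Properties using (↭-length; ∷↭∷ʳ)
open import Data.List.Relation.Unary.Any as Any using (here; there)
open import Data.List.Relation.Unary.Any.Properties using (lookup-index)
open import Data.List.Relation.Unary.All as All using (All; []; _∷_)
import Data.List.Relation.Unary.All.Properties as All
open import Data.List.Relation.Unary.AllPairs as AllPairs using (AllPairs; []; _∷_)
import Data.List.Relation.Unary.AllPairs.Properties as AllPairs
open import Data.List.Relation.Unary.Unique.Propositional using (Unique)
import Data.List.Relation.Unary.Unique.Propositional.Properties as Unique
open import Data.Product using (Σ; ∃; _×_; _,_; proj₂)
open import Data.Sum using (_⊎_; inj₁; inj₂)
open import Data.Empty using (⊥-elim)
open import Function using (_∘_; _on_; id)
open import Function.Bundles using (_⇔_; mk⇔)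
open import Function.Definitions using (Injective)
open import Level using (Level)
open import Relation.Nullary using (¬_; yes; no)
open import Relation.Unary using (Pred; Decidable)
open import Relation.Unary.Properties using (∁?)
open import Relation.Binary using (Rel; tri<; tri≈; tri>)
import Relation.Binary as B
open import Relation.Binary.PropositionalEquality
  using (_≡_; _≢_; refl; sym; trans; cong; cong₂; subst; subst₂; module ≡-Reasoning)

private
  variable
    a ℓ : Level
    A : Set a

ttBound : ℕ → ℕ → ℕ
ttBound zero    n       = 1
ttBound (suc k) zero    = 0
ttBound (suc k) (suc m) = ttBound k ⌈ m /2⌉ + ttBound (suc k) m

ttBound-mono : ∀ k {m n} → m ≤ n → ttBound k m ≤ ttBound k n
ttBound-mono zero    _         = ≤-refl
ttBound-mono (suc k) z≤n       = z≤n
ttBound-mono (suc k) (s≤s m≤n) = +-mono-≤ (ttBound-mono k (⌈n/2⌉-mono m≤n)) (ttBound-mono (suc k) m≤n)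

⌈m/2⌉≤n : ∀ {m n} → m ≤ n + n → ⌈ m /2⌉ ≤ n
⌈m/2⌉≤n {n = n} m≤n+n = ≤-trans (⌈n/2⌉-mono m≤n+n) (≤-reflexive (sym (n≡⌈n+n/2⌉ n)))

⌈m/2⌉≤a⊎⌈m/2⌉≤b : ∀ {a b m} → a + b ≡ m → ⌈ m /2⌉ ≤ a ⊎ ⌈ m /2⌉ ≤ b
⌈m/2⌉≤a⊎⌈m/2⌉≤b {a} {b} refl with ≤-total b a
... | inj₁ b≤a = inj₁ (⌈m/2⌉≤n (+-monoʳ-≤ a b≤a))
... | inj₂ a≤b = inj₂ (⌈m/2⌉≤n (+-monoˡ-≤ b a≤b))

m≤2*⌈m/2⌉ : ∀ m → m ≤ 2 * ⌈ m /2⌉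
m≤2*⌈m/2⌉ m = begin
  m                 ≡⟨ ⌊n/2⌋+⌈n/2⌉≡n m ⟨
  ⌊ m /2⌋ + ⌈ m /2⌉ ≤⟨ +-monoˡ-≤ ⌈ m /2⌉ (⌊n/2⌋≤⌈n/2⌉ m) ⟩
  ⌈ m /2⌉ + ⌈ m /2⌉ ≡⟨ cong (⌈ m /2⌉ +_) (+-identityʳ ⌈ m /2⌉) ⟨
  2 * ⌈ m /2⌉       ∎
  where open ≤-Reasoning

m∸2t≤2*[⌈m/2⌉∸t] : ∀ m t → m ∸ 2 * t ≤ 2 * (⌈ m /2⌉ ∸ t)
m∸2t≤2*[⌈m/2⌉∸t] m t =
  ≤-trans (∸-monoˡ-≤ (2 * t) (m≤2*⌈m/2⌉ m)) (≤-reflexive (sym (*-distribˡ-∸ 2 ⌈ m /2⌉ t)))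

2t≤n⇒n≤2*[n∸t] : ∀ {n t} → 2 * t ≤ n → n ≤ 2 * (n ∸ t)
2t≤n⇒n≤2*[n∸t] {n} {t} 2t≤n = begin
  n             ≤⟨ m+n≤o⇒m≤o∸n n (+-monoʳ-≤ n 2t≤n) ⟩
  n + n ∸ 2 * t ≡⟨ cong (λ m → n + m ∸ 2 * t) (+-identityʳ n) ⟨
  2 * n ∸ 2 * t ≡⟨ *-distribˡ-∸ 2 n t ⟨
  2 * (n ∸ t)   ∎
  where open ≤-Reasoning

^-distribʳ-* : ∀ m n k → (m * n) ^ k ≡ m ^ k * n ^ k
^-distribʳ-* m n zero    = refl
^-distribʳ-* m n (suc k) = trans (cong (m * n *_) (^-distribʳ-* m n k)) (interchange m n (m ^ k) (n ^ k))
  where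
  interchange : ∀ a b x y → a * b * (x * y) ≡ a * x * (b * y)
  interchange = solve-∀

x^[1+k]≤pred[x]^[1+k]+[1+k]*x^k : ∀ k x → x ^ suc k ≤ pred x ^ suc k + suc k * x ^ k
x^[1+k]≤pred[x]^[1+k]+[1+k]*x^k k       zero    = z≤n
x^[1+k]≤pred[x]^[1+k]+[1+k]*x^k zero    (suc a) = ≤-reflexive (+-comm 1 (a * 1))
x^[1+k]≤pred[x]^[1+k]+[1+k]*x^k (suc k) (suc a) = begin
  suc a * suc a ^ suc k
    ≤⟨ *-monoʳ-≤ (suc a) (x^[1+k]≤pred[x]^[1+k]+[1+k]*x^k k (suc a)) ⟩
  suc a * (a ^ suc k + suc k * suc a ^ k)
    ≡⟨ expand a (a ^ suc k) (suc k) (suc a ^ k) ⟩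
  a * a ^ suc k + a ^ suc k + suc k * (suc a * suc a ^ k)
    ≤⟨ +-monoˡ-≤ _ (+-monoʳ-≤ (a * a ^ suc k) (^-monoˡ-≤ (suc k) (n≤1+n a))) ⟩
  a * a ^ suc k + suc a ^ suc k + suc k * suc a ^ suc k
    ≡⟨ collect (a * a ^ suc k) (suc a ^ suc k) k ⟩
  a ^ suc (suc k) + suc (suc k) * suc a ^ suc k
    ∎
  where
  open ≤-Reasoning
  expand : ∀ a p j q → suc a * (p + j * q) ≡ a * p + p + j * (suc a * q)
  expand = solve-∀
  collect : ∀ p q j → p + q + suc j * q ≡ p + suc (suc j) * q
  collect = solve-∀

[1+k]*2^[1+k]≤3^[1+k] : ∀ k → suc k * 2 ^ suc k ≤ 3 ^ suc k
[1+k]*2^[1+k]≤3^[1+k] zero          = n≤1+n 2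
[1+k]*2^[1+k]≤3^[1+k] (suc zero)    = n≤1+n 8
[1+k]*2^[1+k]≤3^[1+k] (suc (suc j)) = begin
  (3 + j) * (2 * p)     ≡⟨ swap (3 + j) p ⟩
  2 * (3 + j) * p       ≤⟨ *-monoˡ-≤ p (m≤m+n (2 * (3 + j)) j) ⟩
  (2 * (3 + j) + j) * p ≡⟨ cong (_* p) (spread j) ⟩
  3 * (2 + j) * p       ≡⟨ *-assoc 3 (2 + j) p ⟩
  3 * ((2 + j) * p)     ≤⟨ *-monoʳ-≤ 3 ([1+k]*2^[1+k]≤3^[1+k] (suc j)) ⟩
  3 * 3 ^ suc (suc j)   ∎
  where
  open ≤-Reasoning
  p : ℕ
  p = 2 ^ suc (suc j)
  swap : ∀ a x → a * (2 * x) ≡ 2 * a * x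
  swap = solve-∀
  spread : ∀ j → 2 * (3 + j) + j ≡ 3 * (2 + j)
  spread = solve-∀

c : ℕ → ℕ
c k = 3 ^ ((k + 1) C 2)

c-suc : ∀ k → c (suc k) ≡ 3 ^ suc k * c k
c-suc k = trans (cong (3 ^_) [k+2]C2≡k+1+[k+1]C2) (^-distribˡ-+-* 3 (suc k) ((k + 1) C 2))
  where
  open ≡-Reasoning
  [k+2]C2≡k+1+[k+1]C2 : suc (k + 1) C 2 ≡ suc k + (k + 1) C 2
  [k+2]C2≡k+1+[k+1]C2 = begin
    suc (k + 1) C 2           ≡⟨ nCk+nC[k+1]≡[n+1]C[k+1] (k + 1) 1 ⟨
    (k + 1) C 1 + (k + 1) C 2 ≡⟨ cong (_+ (k + 1) C 2) (trans (nC1≡n (k + 1)) (+-comm k 1)) ⟩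
    suc k + (k + 1) C 2       ∎

offset : ℕ → ℕ
offset zero    = 0
offset (suc k) = suc (2 * offset k)

offset-suc≤c : ∀ k → offset (suc k) ≤ c k
offset-suc≤c zero    = ≤-refl
offset-suc≤c (suc k) = begin
  1 + 2 * offset (suc k) ≤⟨ +-monoʳ-≤ 1 (*-monoʳ-≤ 2 (offset-suc≤c k)) ⟩
  1 + 2 * c k            ≤⟨ +-monoˡ-≤ (2 * c k) (m^n>0 3 ((k + 1) C 2)) ⟩
  3 * c k                ≤⟨ *-monoˡ-≤ (c k) (^-monoʳ-≤ 3 (s≤s (z≤n {k}))) ⟩
  3 ^ suc k * c k        ≡⟨ c-suc k ⟨
  c (suc k)              ∎
  where open ≤-Reasoning

ttBound-step : ∀ k m →
  (2 * (m ∸ offset (suc k))) ^ suc k ≤ c (suc k) * ttBound (suc k) m →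
  (2 * (⌈ m /2⌉ ∸ offset k)) ^ k ≤ c k * ttBound k ⌈ m /2⌉ →
  (2 * (suc m ∸ offset (suc k))) ^ suc k ≤ c (suc k) * ttBound (suc k) (suc m)
ttBound-step k m ih₁ ih₀ = begin
  (2 * x) ^ suc k                               ≡⟨ ^-distribʳ-* 2 x (suc k) ⟩
  2 ^ suc k * x ^ suc k                         ≤⟨ *-monoʳ-≤ (2 ^ suc k) (x^[1+k]≤pred[x]^[1+k]+[1+k]*x^k k x) ⟩
  2 ^ suc k * (pred x ^ suc k + suc k * x ^ k)  ≡⟨ spread (2 ^ suc k) (pred x ^ suc k) (suc k) (x ^ k) ⟩
  2 ^ suc k * pred x ^ suc k + t                ≡⟨ cong (_+ t) (^-distribʳ-* 2 (pred x) (suc k)) ⟨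
  (2 * pred x) ^ suc k + t                      ≤⟨ +-mono-≤ ih₁′ ih₀′ ⟩
  c (suc k) * g₁ + 3 ^ suc k * (c k * g₀)       ≡⟨ cong (λ a → a * g₁ + 3 ^ suc k * (c k * g₀)) (c-suc k) ⟩
  3 ^ suc k * c k * g₁ + 3 ^ suc k * (c k * g₀) ≡⟨ collect (3 ^ suc k) (c k) g₁ g₀ ⟩
  3 ^ suc k * c k * (g₀ + g₁)                   ≡⟨ cong (_* (g₀ + g₁)) (c-suc k) ⟨
  c (suc k) * (g₀ + g₁)                         ∎
  where
  open ≤-Reasoning
  x t g₀ g₁ : ℕ
  x  = m ∸ 2 * offset k
  t  = suc k * 2 ^ suc k * x ^ k
  g₀ = ttBound k ⌈ m /2⌉
  g₁ = ttBound (suc k) m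
  spread : ∀ a p j q → a * (p + j * q) ≡ a * p + j * a * q
  spread = solve-∀
  collect : ∀ a b g₁ g₀ → a * b * g₁ + a * (b * g₀) ≡ a * b * (g₀ + g₁)
  collect = solve-∀
  ih₁′ : (2 * pred x) ^ suc k ≤ c (suc k) * g₁
  ih₁′ = subst (λ y → (2 * y) ^ suc k ≤ c (suc k) * g₁) (sym (pred[m∸n]≡m∸[1+n] m (2 * offset k))) ih₁
  ih₀′ : t ≤ 3 ^ suc k * (c k * g₀)
  ih₀′ = *-mono-≤ ([1+k]*2^[1+k]≤3^[1+k] k)
                  (≤-trans (^-monoˡ-≤ k (m∸2t≤2*[⌈m/2⌉∸t] m (offset k))) ih₀)

[2*[n∸offset]]^k≤c*ttBound : ∀ k n → (2 * (n ∸ offset k)) ^ k ≤ c k * ttBound k n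
[2*[n∸offset]]^k≤c*ttBound zero    n       = ≤-refl
[2*[n∸offset]]^k≤c*ttBound (suc k) zero    = z≤n
[2*[n∸offset]]^k≤c*ttBound (suc k) (suc m) =
  ttBound-step k m ([2*[n∸offset]]^k≤c*ttBound (suc k) m) ([2*[n∸offset]]^k≤c*ttBound k ⌈ m /2⌉)

n^k≤c*ttBound : ∀ k {n} → c k ≤ n → n ^ k ≤ c k * ttBound k n
n^k≤c*ttBound k {n} c≤n =
  ≤-trans (^-monoˡ-≤ k (2t≤n⇒n≤2*[n∸t] {n} {offset k} 2*offset≤n)) ([2*[n∸offset]]^k≤c*ttBound k n)
  where
  2*offset≤n : 2 * offset k ≤ n
  2*offset≤n = ≤-trans (n≤1+n _) (≤-trans (offset-suc≤c k) c≤n)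

length-filter+length-filter-∁ : ∀ {P : Pred A ℓ} (P? : Decidable P) xs →
  length (filter P? xs) + length (filter (∁? P?) xs) ≡ length xs
length-filter+length-filter-∁ P? []       = refl
length-filter+length-filter-∁ P? (x ∷ xs) with P? x
... | yes _ = cong suc (length-filter+length-filter-∁ P? xs)
... | no  _ = trans (+-suc _ _) (cong suc (length-filter+length-filter-∁ P? xs))

AllPairs-lookup : ∀ {R : Rel A ℓ} {xs} → AllPairs R xs → ∀ {i j} → i <ᶠ j → R (lookup xs i) (lookup xs j)
AllPairs-lookup (Rx ∷ _)  {zero}  {suc j} _         = All.lookup Rx (∈-lookup j)
AllPairs-lookup (_  ∷ Rs) {suc i} {suc j} (s≤s i<j) = AllPairs-lookup Rs i<j

infix 4 _≉_

_≉_ : {A : Set a} → List A → List A → Set a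
xs ≉ ys = ¬ (xs ⊆ ys × ys ⊆ xs)

∈∧∉⇒≉ : ∀ {x : A} {xs ys} → x ∈ xs → x ∉ ys → xs ≉ ys
∈∧∉⇒≉ x∈xs x∉ys (xs⊆ys , _) = x∉ys (xs⊆ys x∈xs)

∷-≉ : ∀ {x : A} {xs ys} → x ∉ xs → x ∉ ys → xs ≉ ys → x ∷ xs ≉ x ∷ ys
∷-≉ x∉xs x∉ys xs≉ys (⊆ , ⊇) =
  xs≉ys (⊆∷∧∉⇒⊆ (⊆ ∘ there) x∉xs , ⊆∷∧∉⇒⊆ (⊇ ∘ there) x∉ys)

≉-resp-↭ : ∀ {xs xs′ ys ys′ : List A} → xs ↭ xs′ → ys ↭ ys′ → xs ≉ ys → xs′ ≉ ys′
≉-resp-↭ xs↭xs′ ys↭ys′ xs≉ys (⊆ , ⊇) = xs≉ys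
  ( ⊆-reflexive-↭ (↭-sym ys↭ys′) ∘ ⊆ ∘ ⊆-reflexive-↭ xs↭xs′
  , ⊆-reflexive-↭ (↭-sym xs↭xs′) ∘ ⊇ ∘ ⊆-reflexive-↭ ys↭ys′ )

⟦_⟧ : ∀ {n} → List (Fin n) → Subset n
⟦ xs ⟧ = ⋃ (map ⁅_⁆ xs)

∈⟦⟧⁺ : ∀ {n} {x : Fin n} {xs} → x ∈ xs → x ∈ₛ ⟦ xs ⟧
∈⟦⟧⁺ (here refl)  = x∈p∪q⁺ (inj₁ (x∈⁅x⁆ _))
∈⟦⟧⁺ (there x∈xs) = x∈p∪q⁺ (inj₂ (∈⟦⟧⁺ x∈xs))

∈⟦⟧⁻ : ∀ {n} {x : Fin n} xs → x ∈ₛ ⟦ xs ⟧ → x ∈ xs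
∈⟦⟧⁻ []       x∈⊥ = ⊥-elim (∉⊥ x∈⊥)
∈⟦⟧⁻ (y ∷ xs) x∈⟦y∷xs⟧ with x∈p∪q⁻ ⁅ y ⁆ ⟦ xs ⟧ x∈⟦y∷xs⟧
... | inj₁ x∈⁅y⁆  = here (x∈⁅y⁆⇒x≡y y x∈⁅y⁆)
... | inj₂ x∈⟦xs⟧ = there (∈⟦⟧⁻ xs x∈⟦xs⟧)

≉⇒⟦⟧≢ : ∀ {n} {xs ys : List (Fin n)} → xs ≉ ys → ⟦ xs ⟧ ≢ ⟦ ys ⟧
≉⇒⟦⟧≢ {xs = xs} {ys} xs≉ys ⟦xs⟧≡⟦ys⟧ = xs≉ys
  ( ∈⟦⟧⁻ ys ∘ subst (_ ∈ₛ_) ⟦xs⟧≡⟦ys⟧ ∘ ∈⟦⟧⁺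
  , ∈⟦⟧⁻ xs ∘ subst (_ ∈ₛ_) (sym ⟦xs⟧≡⟦ys⟧) ∘ ∈⟦⟧⁺ )

module _ {N : ℕ} (T : Tournament N) where

  open Tournament T

  _⇒?_ : B.Decidable _⇒_
  u ⇒? v with u ≟ v
  ... | yes refl = no (irrefl u)
  ... | no u≢v with total u v u≢v
  ...   | inj₁ u⇒v = yes u⇒v
  ...   | inj₂ v⇒u = no (antisym v u v⇒u)

  -- Γ⁻ v L is the in-neighbourhood of v in L only when v ∉ L.
  Γ⁺ Γ⁻ : Fin N → List (Fin N) → List (Fin N)
  Γ⁺ v = filter (v ⇒?_)
  Γ⁻ v = filter (∁? (v ⇒?_))

  -- A copy of TT_k is kept as its vertex list in transitive order; two copies are
  -- the same subtournament exactly when their vertex sets agree.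
  record Copy (k : ℕ) (L : List (Fin N)) : Set where
    field
      vertices : List (Fin N)
      ordered  : AllPairs _⇒_ vertices
      size     : length vertices ≡ k
      within   : vertices ⊆ L

  open Copy

  record Extension (v : Fin N) (S : List (Fin N)) : Set where
    field
      extend  : List (Fin N) → List (Fin N)
      ↭-∷     : ∀ c → v ∷ c ↭ extend c
      ordered : ∀ {c} → c ⊆ S → AllPairs _⇒_ c → AllPairs _⇒_ (extend c)

  asSource : ∀ v L → Extension v (Γ⁺ v L)
  asSource v L = record
    { extend  = v ∷_
    ; ↭-∷     = λ _ → ↭-refl
    ; ordered = λ c⊆Γ⁺ c↓ → All.tabulate (proj₂ ∘ ∈-filter⁻ (v ⇒?_) {xs = L} ∘ c⊆Γ⁺) ∷ c↓
    }

  asSink : ∀ {v L} → v ∉ L → Extension v (Γ⁻ v L)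
  asSink {v} {L} v∉L = record
    { extend  = _∷ʳ v
    ; ↭-∷     = ∷↭∷ʳ v
    ; ordered = λ c⊆Γ⁻ c↓ → AllPairs.++⁺ c↓ ([] ∷ []) (All.tabulate ((_∷ []) ∘ beats ∘ c⊆Γ⁻))
    }
    where
    beats : ∀ {w} → w ∈ Γ⁻ v L → w ⇒ v
    beats w∈Γ⁻ with ∈-filter⁻ (∁? (v ⇒?_)) {xs = L} w∈Γ⁻
    ... | w∈L , v⇏w with total _ v (λ { refl → v∉L w∈L })
    ...   | inj₁ w⇒v = w⇒v
    ...   | inj₂ v⇒w = ⊥-elim (v⇏w v⇒w)

  extendCopy : ∀ {k v S L} → Extension v S → S ⊆ L → Copy k S → Copy (suc k) (v ∷ L)
  extendCopy {v = v} {L = L} E S⊆L c = record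
    { vertices = extend (vertices c)
    ; ordered  = Extension.ordered E (within c) (ordered c)
    ; size     = trans (sym (↭-length (↭-∷ (vertices c)))) (cong suc (size c))
    ; within   = v∷c⊆v∷L ∘ ⊆-reflexive-↭ (↭-sym (↭-∷ (vertices c)))
    }
    where
    open Extension E using (extend; ↭-∷)
    v∷c⊆v∷L : v ∷ vertices c ⊆ v ∷ L
    v∷c⊆v∷L (here refl)  = here refl
    v∷c⊆v∷L (there w∈c) = there (S⊆L (within c w∈c))

  weakenCopy : ∀ {k v L} → Copy k L → Copy k (v ∷ L)
  weakenCopy c = record
    { vertices = vertices c ; ordered = ordered c ; size = size c ; within = there ∘ within c }

  record Family (k : ℕ) (L : List (Fin N)) : Set where
    field
      members  : List (Copy k L)
      distinct : AllPairs (_≉_ on vertices) members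
      large    : ttBound k (length L) ≤ length members

  open Family

  join : ∀ {k v S L} → Extension v S → v ∉ L → S ⊆ L → ⌈ length L /2⌉ ≤ length S →
         Family k S → Family (suc k) L → Family (suc k) (v ∷ L)
  join {k} {v} {S} {L} E v∉L S⊆L half F G = record
    { members  = new ++ old
    ; distinct = AllPairs.++⁺ (AllPairs.map⁺ (AllPairs.map (λ {c d} → new≉new {c} {d}) (distinct F)))
                              (AllPairs.map⁺ (distinct G))
                              new≉old
    ; large    = begin
        ttBound k ⌈ length L /2⌉ + ttBound (suc k) (length L)
          ≤⟨ +-mono-≤ (≤-trans (ttBound-mono k half) (large F)) (large G) ⟩
        length (members F) + length (members G)
          ≡⟨ cong₂ _+_ (length-map _ (members F)) (length-map _ (members G)) ⟨
        length new + length old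
          ≡⟨ length-++ new ⟨
        length (new ++ old)
          ∎
    }
    where
    open ≤-Reasoning
    open Extension E using (↭-∷)
    new old : List (Copy (suc k) (v ∷ L))
    new = map (extendCopy E S⊆L) (members F)
    old = map (weakenCopy {v = v}) (members G)
    new≉new : ∀ {c d : Copy k S} → (_≉_ on vertices) c d → (_≉_ on (vertices ∘ extendCopy E S⊆L)) c d
    new≉new {c} {d} c≉d = ≉-resp-↭ (↭-∷ (vertices c)) (↭-∷ (vertices d))
                            (∷-≉ (v∉L ∘ S⊆L ∘ within c) (v∉L ∘ S⊆L ∘ within d) c≉d)
    v∈new : ∀ (c : Copy k S) → v ∈ vertices (extendCopy E S⊆L c)
    v∈new c = ⊆-reflexive-↭ (↭-∷ (vertices c)) (here refl)
    new≉old : All (λ c → All ((_≉_ on vertices) c) old) new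
    new≉old = All.map⁺ (All.universal (λ c → All.map⁺ (All.universal (λ d → ∈∧∉⇒≉ (v∈new c) (v∉L ∘ within d))
                                                                      (members G)))
                                      (members F))

  family : ∀ k L → Unique L → Family k L
  family zero    L       _ = record
    { members  = [ record { vertices = [] ; ordered = [] ; size = refl ; within = λ () } ]
    ; distinct = [] ∷ []
    ; large    = ≤-refl
    }
  family (suc k) []      _ = record { members = [] ; distinct = [] ; large = z≤n }
  family (suc k) (v ∷ L) (v≢L ∷ L!) =
    grow (⌈m/2⌉≤a⊎⌈m/2⌉≤b (length-filter+length-filter-∁ (v ⇒?_) L))
      (family k (Γ⁺ v L) (Unique.filter⁺ _ L!)) (family k (Γ⁻ v L) (Unique.filter⁺ _ L!)) (family (suc k) L L!)
    where
    v∉L : v ∉ L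
    v∉L = All.All¬⇒¬Any v≢L
    grow : ⌈ length L /2⌉ ≤ length (Γ⁺ v L) ⊎ ⌈ length L /2⌉ ≤ length (Γ⁻ v L) →
           Family k (Γ⁺ v L) → Family k (Γ⁻ v L) → Family (suc k) L → Family (suc k) (v ∷ L)
    grow (inj₁ half) F⁺ _  G = join (asSource v L) v∉L (filter-⊆ _ L) half F⁺ G
    grow (inj₂ half) _  F⁻ G = join (asSink v∉L) v∉L (filter-⊆ _ L) half F⁻ G

  ordered⇒IsCopyTT : ∀ {xs} → AllPairs _⇒_ xs → IsCopyTT T (length xs) ⟦ xs ⟧
  ordered⇒IsCopyTT {xs} xs↓ = lookup xs , injective , members⇔ , edges⇔
    where
    lookup-≢ : ∀ {i j} → i <ᶠ j → lookup xs i ≢ lookup xs j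
    lookup-≢ i<j eq = irrefl _ (subst (_⇒ _) eq (AllPairs-lookup xs↓ i<j))
    injective : Injective _≡_ _≡_ (lookup xs)
    injective {i} {j} eq with <-cmp i j
    ... | tri< i<j _ _ = ⊥-elim (lookup-≢ i<j eq)
    ... | tri≈ _ i≡j _ = i≡j
    ... | tri> _ _ j<i = ⊥-elim (lookup-≢ j<i (sym eq))
    members⇔ : ∀ w → w ∈ₛ ⟦ xs ⟧ ⇔ ∃ λ i → lookup xs i ≡ w
    members⇔ w = mk⇔ (λ w∈ → let w∈xs = ∈⟦⟧⁻ xs w∈ in Any.index w∈xs , sym (lookup-index w∈xs))
                     (λ { (i , refl) → ∈⟦⟧⁺ (∈-lookup {xs = xs} i) })
    edges⇔ : ∀ i j → lookup xs i ⇒ lookup xs j ⇔ i <ᶠ j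
    edges⇔ i j = mk⇔ ⇒⇒< (AllPairs-lookup xs↓)
      where
      ⇒⇒< : lookup xs i ⇒ lookup xs j → i <ᶠ j
      ⇒⇒< i⇒j with <-cmp i j
      ... | tri< i<j _ _  = i<j
      ... | tri≈ _ refl _ = ⊥-elim (irrefl _ i⇒j)
      ... | tri> _ _ j<i  = ⊥-elim (antisym _ _ i⇒j (AllPairs-lookup xs↓ j<i))

  Copy⇒IsCopyTT : ∀ {k L} (c : Copy k L) → IsCopyTT T k ⟦ vertices c ⟧
  Copy⇒IsCopyTT c = subst (λ k → IsCopyTT T k ⟦ vertices c ⟧) (size c) (ordered⇒IsCopyTT (ordered c))

  ttCopies : ∀ k → Σ (List (Subset N)) λ copies →
    Unique copies × All (IsCopyTT T k) copies × ttBound k N ≤ length copies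
  ttCopies k = map (⟦_⟧ ∘ vertices) (members F)
             , AllPairs.map⁺ (AllPairs.map ≉⇒⟦⟧≢ (distinct F))
             , All.map⁺ (All.universal Copy⇒IsCopyTT (members F))
             , subst₂ _≤_ (cong (ttBound k) (length-tabulate id)) (sym (length-map _ (members F))) (large F)
    where
    F : Family k (allFin N)
    F = family k (allFin N) (Unique.allFin⁺ N)

lemma23 : (k N : ℕ) → 1 ≤ k → 3 ^ ((k + 1) C 2) ≤ N → (T : Tournament N) →
    Σ (List (Subset N)) λ copies →
    Unique copies × All (IsCopyTT T k) copies ×
    N ^ k ≤ length copies * 3 ^ ((k + 1) C 2)
lemma23 k N _ c≤N T with ttCopies T k
... | copies , unique , areCopies , many = copies , unique , areCopies , (begin
  N ^ k               ≤⟨ n^k≤c*ttBound k c≤N ⟩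
  c k * ttBound k N   ≤⟨ *-monoʳ-≤ (c k) many ⟩
  c k * length copies ≡⟨ *-comm (c k) (length copies) ⟩
  length copies * c k ∎)
  where open ≤-Reasoning
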